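{- Let $k\ge4$ be an integer and $0<\delta<1/2$. Then $$\mathrm{Emb}(1,\delta,k)\ge\frac15\,\frac{2^k\log(1/\delta)}{\log k}.$$
   Context: $\log$ is base 2. $\{0,1\}^N$ carries the Hamming metric $\|x-y\|_1$. $\mathrm{Emb}(1,\delta,k)$ is the smallest $N$ such that for every $\mathcal D\subset\{0,1\}^N$ with $|\mathcal D|\ge\delta2^N$ there exist $r>0$ and $f:\{0,1\}^k\to\mathcal D$ with $\|f(x)-f(y)\|_1=r\|x-y\|_1$ for all $x,y\in\{0,1\}^k$.
   Formalization: The parameter δ takes only rational values in the interval $0<\delta<1/2$. -}

module Defs where

open import Data.Bool using (Bool; true; false; if_then_else_)
open import Data.Nat using (ℕ; zero; suc; _+_)
open import Data.Integer using (+_)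
open import Data.Rational using (ℚ; _/_; _*_; _≤_; _<_; 0ℚ; 1ℚ)
open import Data.Vec using (Vec; []; _∷_)
open import Data.List using (List; []; _∷_; map; _++_; length; filter)
open import Data.Product using (Σ; _×_; _,_)
open import Relation.Nullary.Decidable using (Dec)
open import Relation.Binary.PropositionalEquality using (_≡_)
open import Data.Bool using (T)
open import Data.Bool.Properties using (T?)

Cube : ℕ → Set
Cube N = Vec Bool N

hamming : ∀ {N} → Cube N → Cube N → ℕ
hamming []       []       = 0
hamming (a ∷ x) (b ∷ y) = (if a Data.Bool.xor b then 1 else 0) + hamming x y

allPoints : ∀ N → List (Cube N)
allPoints zero    = [] ∷ []
allPoints (suc N) = map (false ∷_) (allPoints N) ++ map (true ∷_) (allPoints N)

card : ∀ {N} → (Cube N → Bool) → ℕ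
card {N} D = length (filter (λ x → T? (D x)) (allPoints N))

ℕtoℚ : ℕ → ℚ
ℕtoℚ n = + n / 1

_^ℚ_ : ℚ → ℕ → ℚ
q ^ℚ zero  = 1ℚ
q ^ℚ suc n = q * (q ^ℚ n)

ScaledEmbeddingInto : ∀ {N} (k : ℕ) → (Cube N → Bool) → Set
ScaledEmbeddingInto {N} k D =
  Σ ℚ λ r → (0ℚ < r) × Σ (Cube k → Cube N) λ f →
    ((x : Cube k) → T (D (f x))) ×
    ((x y : Cube k) → ℕtoℚ (hamming (f x) (f y)) ≡ r * ℕtoℚ (hamming x y))

-- N has the property defining Emb(1,δ,k): every D ⊆ {0,1}^N with |D| ≥ δ 2^N
-- contains a scaled copy of {0,1}^k.  Emb(1,δ,k) is the least such N.
EmbProperty : ℚ → ℕ → ℕ → Set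
EmbProperty δ k N =
  (D : Cube N → Bool) → δ * ℕtoℚ (2 Data.Nat.^ N) ≤ ℕtoℚ (card D) →
  ScaledEmbeddingInto k D

{-# OPTIONS --safe #-}
module Submission where

-- Write δ = u/v and s = 2^k, and suppose v^s > u^s k^(5N).  A scaled copy f of {0,1}^k in
-- {0,1}^N is rigid: once f(0) is translated to 0, the identity |x ⊕ y| + 2|x ∩ y| = |x| + |y|
-- gives |f x ∩ f y| = r |x ∩ y|, so f preserves unions and disjointness and f x is the
-- disjoint union of the blocks f(e_i), i ∈ x.  A copy is therefore described by a base point
-- and a map [N] → {0,…,k}: there are at most 2^N (k+1)^N copies, each with s points.  Keep
-- each point with probability p and delete one point from every copy that survives; the
-- expected size is at least (p − (k+1)^N p^s) 2^N, which for p = 2δ (δ ≤ 1/4) or p = 3/5 is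
-- at least δ 2^N because ((k+1)^N)^4 ≤ k^(5N) < δ^(−s).  Conditional expectations turn this
-- into a set of density at least δ containing no copy, contradicting the embedding property.

module Hypergraphs where

  open import Data.Bool using (Bool; true; false; T)
  open import Data.Bool.Properties using (T?; T-≡)
  open import Data.Empty using (⊥-elim)
  open import Data.List using (List; []; _∷_; map; length; filter)
  open import Data.List.Membership.Propositional using (_∈_; find; lose)
  open import Data.List.Properties using (map-cong; map-cong-local)
  open import Data.List.Relation.Unary.All as All using (All; []; _∷_)
  open import Data.List.Relation.Unary.Any using (here; there; any?)
  open import Data.List.Relation.Unary.AllPairs using ([]; _∷_)
  open import Data.List.Relation.Unary.Unique.Propositional using (Unique)
  open import Data.Maybe using (Maybe; just; nothing; fromMaybe)
  open import Data.Nat using (ℕ; suc; >-nonZero; _+_; _*_; _∸_; _^_; _≤_; _<_; _≤?_; z≤n)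
  open import Data.Nat.Induction using (<-wellFounded)
  open import Data.Nat.ListAction using (sum; product)
  open import Data.Nat.Properties
  open import Data.Nat.Tactic.RingSolver using (solve-∀)
  open import Data.Product using (∃; _×_; _,_)
  open import Data.Sum using (_⊎_; inj₁; inj₂)
  open import Function using (_∘_; id; const)
  open import Function.Bundles using (Equivalence)
  open import Induction.WellFounded using (Acc; acc)
  open import Relation.Binary using (DecidableEquality)
  open import Relation.Binary.PropositionalEquality
  open import Relation.Nullary using (¬_; yes; no)

  sum-mono : ∀ {A : Set} {f g : A → ℕ} xs → (∀ x → f x ≤ g x) → sum (map f xs) ≤ sum (map g xs)
  sum-mono []       f≤g = z≤n
  sum-mono (x ∷ xs) f≤g = +-mono-≤ (f≤g x) (sum-mono xs f≤g)

  sum-mono-with-gap : ∀ {A : Set} {f g : A → ℕ} {x xs} d → x ∈ xs → (∀ y → f y ≤ g y) → f x + d ≤ g x →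
    sum (map f xs) + d ≤ sum (map g xs)
  sum-mono-with-gap {f = f} {g} {xs = y ∷ ys} d (here refl) f≤g fy+d≤gy = begin
    f y + sum (map f ys) + d    ≡⟨ +-assoc (f y) _ d ⟩
    f y + (sum (map f ys) + d)  ≡⟨ cong (f y +_) (+-comm _ d) ⟩
    f y + (d + sum (map f ys))  ≡⟨ +-assoc (f y) d _ ⟨
    f y + d + sum (map f ys)    ≤⟨ +-mono-≤ fy+d≤gy (sum-mono ys f≤g) ⟩
    g y + sum (map g ys)        ∎
    where open ≤-Reasoning
  sum-mono-with-gap {f = f} {g} {xs = y ∷ ys} d (there x∈ys) f≤g fx+d≤gx = begin
    f y + sum (map f ys) + d    ≡⟨ +-assoc (f y) _ d ⟩
    f y + (sum (map f ys) + d)  ≤⟨ +-mono-≤ (f≤g y) (sum-mono-with-gap d x∈ys f≤g fx+d≤gx) ⟩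
    g y + sum (map g ys)        ∎
    where open ≤-Reasoning

  sum-const : ∀ {A : Set} (xs : List A) n → sum (map (const n) xs) ≡ length xs * n
  sum-const []       n = refl
  sum-const (x ∷ xs) n = cong (n +_) (sum-const xs n)

  product-mono : ∀ {A : Set} {f g : A → ℕ} xs → (∀ x → f x ≤ g x) → product (map f xs) ≤ product (map g xs)
  product-mono []       f≤g = ≤-refl
  product-mono (x ∷ xs) f≤g = *-mono-≤ (f≤g x) (product-mono xs f≤g)

  product-const : ∀ {A : Set} (xs : List A) n → product (map (const n) xs) ≡ n ^ length xs
  product-const []       n = refl
  product-const (x ∷ xs) n = cong (n *_) (product-const xs n)

  product-zero : ∀ {A : Set} (f : A → ℕ) {x xs} → x ∈ xs → f x ≡ 0 → product (map f xs) ≡ 0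
  product-zero f {xs = y ∷ ys} (here refl)  fx≡0 = cong (_* product (map f ys)) fx≡0
  product-zero f {xs = y ∷ ys} (there x∈ys) fx≡0 = trans (cong (f y *_) (product-zero f x∈ys fx≡0)) (*-zeroʳ (f y))

  module Convexity {a b c : ℕ} (a+c≡b : a + c ≡ b) where

    Convex : ℕ → ℕ → ℕ → Set
    Convex X Y Z = b * X ≡ a * Y + c * Z

    convex-refl : ∀ X → Convex X X X
    convex-refl X = begin
      b * X          ≡⟨ cong (_* X) a+c≡b ⟨
      (a + c) * X    ≡⟨ *-distribʳ-+ X a c ⟩
      a * X + c * X  ∎
      where open ≡-Reasoning

    convex-extreme : Convex a b 0
    convex-extreme = swap a b c
      where
      swap : ∀ a b c → b * a ≡ a * b + c * 0
      swap = solve-∀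

    convex-+ : ∀ {X Y Z X′ Y′ Z′} → Convex X Y Z → Convex X′ Y′ Z′ → Convex (X + X′) (Y + Y′) (Z + Z′)
    convex-+ {X} {Y} {Z} {X′} {Y′} {Z′} e e′ = begin
      b * (X + X′)                       ≡⟨ *-distribˡ-+ b X X′ ⟩
      b * X + b * X′                     ≡⟨ cong₂ _+_ e e′ ⟩
      a * Y + c * Z + (a * Y′ + c * Z′)  ≡⟨ regroup a c Y Z Y′ Z′ ⟩
      a * (Y + Y′) + c * (Z + Z′)        ∎
      where
      open ≡-Reasoning
      regroup : ∀ a c Y Z Y′ Z′ → a * Y + c * Z + (a * Y′ + c * Z′) ≡ a * (Y + Y′) + c * (Z + Z′)
      regroup = solve-∀

    convex-*ˡ : ∀ m {X Y Z} → Convex X Y Z → Convex (m * X) (m * Y) (m * Z)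
    convex-*ˡ m {X} {Y} {Z} e = begin
      b * (m * X)                ≡⟨ swap b m X ⟩
      m * (b * X)                ≡⟨ cong (m *_) e ⟩
      m * (a * Y + c * Z)        ≡⟨ regroup m a c Y Z ⟩
      a * (m * Y) + c * (m * Z)  ∎
      where
      open ≡-Reasoning
      swap : ∀ b m X → b * (m * X) ≡ m * (b * X)
      swap = solve-∀
      regroup : ∀ m a c Y Z → m * (a * Y + c * Z) ≡ a * (m * Y) + c * (m * Z)
      regroup = solve-∀

    convex-*ʳ : ∀ m {X Y Z} → Convex X Y Z → Convex (X * m) (Y * m) (Z * m)
    convex-*ʳ m {X} {Y} {Z} e =
      subst₂ (λ P Q → b * P ≡ Q) (*-comm m X) (cong₂ _+_ (cong (a *_) (*-comm m Y)) (cong (c *_) (*-comm m Z)))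
        (convex-*ˡ m e)

    sum-convex : ∀ {A : Set} {f g h : A → ℕ} xs → (∀ {x} → x ∈ xs → Convex (f x) (g x) (h x)) →
      Convex (sum (map f xs)) (sum (map g xs)) (sum (map h xs))
    sum-convex []       _      = convex-refl 0
    sum-convex (x ∷ xs) convex = convex-+ (convex (here refl)) (sum-convex xs (convex ∘ there))

    convex-≤ : 0 < a → ∀ {X Y Z X′ Y′ Z′} → Convex X Y Z → Convex X′ Y′ Z′ →
      X ≤ X′ → Y ≤ Y′ ⊎ Z ≤ Z′
    convex-≤ 0<a {X} {Y} {Z} {X′} {Y′} {Z′} e e′ X≤X′ with Y ≤? Y′ | Z ≤? Z′
    ... | yes Y≤Y′ | _        = inj₁ Y≤Y′
    ... | no _     | yes Z≤Z′ = inj₂ Z≤Z′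
    ... | no Y≰Y′  | no Z≰Z′  = ⊥-elim (<-irrefl refl (begin-strict
      b * X′           ≡⟨ e′ ⟩
      a * Y′ + c * Z′  <⟨ +-mono-<-≤ aY′<aY cZ′≤cZ ⟩
      a * Y + c * Z    ≡⟨ e ⟨
      b * X            ≤⟨ *-monoʳ-≤ b X≤X′ ⟩
      b * X′           ∎))
      where
      open ≤-Reasoning
      aY′<aY : a * Y′ < a * Y
      aY′<aY = *-monoʳ-< a {{>-nonZero 0<a}} (≰⇒> Y≰Y′)
      cZ′≤cZ : c * Z′ ≤ c * Z
      cZ′≤cZ = *-monoʳ-≤ c (<⇒≤ (≰⇒> Z≰Z′))

  module Update {V : Set} (_≟_ : DecidableEquality V) where

    infixl 10 _[_≔_]
    _[_≔_] : {A : Set} → (V → A) → V → A → V → A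
    (f [ y ≔ x ]) v with v ≟ y
    ... | yes _ = x
    ... | no _  = f v

    [≔]-same : ∀ {A : Set} (f : V → A) y x → (f [ y ≔ x ]) y ≡ x
    [≔]-same f y x with y ≟ y
    ... | yes _   = refl
    ... | no y≢y  = ⊥-elim (y≢y refl)

    [≔]-other : ∀ {A : Set} (f : V → A) {y} x {v} → v ≢ y → (f [ y ≔ x ]) v ≡ f v
    [≔]-other f {y} x {v} v≢y with v ≟ y
    ... | yes v≡y = ⊥-elim (v≢y v≡y)
    ... | no _    = refl

    [≔]-id : ∀ {A : Set} (f : V → A) {y x} → f y ≡ x → f [ y ≔ x ] ≗ f
    [≔]-id f {y} fy≡x v with v ≟ y
    ... | yes refl = sym fy≡x
    ... | no _     = refl

    ∘-[≔] : ∀ {A B : Set} (g : A → B) (f : V → A) y x → g ∘ f [ y ≔ x ] ≗ (g ∘ f) [ y ≔ g x ]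
    ∘-[≔] g f y x v with v ≟ y
    ... | yes _ = refl
    ... | no _  = refl

    map-[≔]-∉ : ∀ {A B : Set} (g : A → B) (f : V → A) {y} x {vs} → All (y ≢_) vs →
      map (g ∘ f [ y ≔ x ]) vs ≡ map (g ∘ f) vs
    map-[≔]-∉ g f x y∉vs = map-cong-local (All.map (λ y≢v → cong g ([≔]-other f x (y≢v ∘ sym))) y∉vs)

    sum-[≔] : ∀ (f : V → ℕ) {y} x {vs} → Unique vs → y ∈ vs → sum (map (f [ y ≔ x ]) vs) + f y ≡ sum (map f vs) + x
    sum-[≔] f {y} x {y ∷ vs} (y∉vs ∷ _) (here refl) = begin
      (f [ y ≔ x ]) y + sum (map (f [ y ≔ x ]) vs) + f y
        ≡⟨ cong₂ (λ p q → p + q + f y) ([≔]-same f y x) (cong sum (map-[≔]-∉ id f x y∉vs)) ⟩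
      x + sum (map f vs) + f y
        ≡⟨ swap-ends x (sum (map f vs)) (f y) ⟩
      f y + sum (map f vs) + x
        ∎
      where
      open ≡-Reasoning
      swap-ends : ∀ x s w → x + s + w ≡ w + s + x
      swap-ends = solve-∀
    sum-[≔] f {y} x {v ∷ vs} (v∉vs ∷ vs-unique) (there y∈vs) = begin
      (f [ y ≔ x ]) v + sum (map (f [ y ≔ x ]) vs) + f y  ≡⟨ cong (λ p → p + _ + f y) ([≔]-other f x v≢y) ⟩
      f v + sum (map (f [ y ≔ x ]) vs) + f y              ≡⟨ +-assoc (f v) _ (f y) ⟩
      f v + (sum (map (f [ y ≔ x ]) vs) + f y)            ≡⟨ cong (f v +_) (sum-[≔] f x vs-unique y∈vs) ⟩
      f v + (sum (map f vs) + x)                          ≡⟨ +-assoc (f v) _ x ⟨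
      f v + sum (map f vs) + x                            ∎
      where
      open ≡-Reasoning
      v≢y : v ≢ y
      v≢y refl = All.lookup v∉vs y∈vs refl


  module DeletionMethod
    {V E : Set} (_≟_ : DecidableEquality V)
    (vertices : List V) (vertices-unique : Unique vertices) (∈-vertices : ∀ v → v ∈ vertices)
    (edges : List E) (pts : E → List V) (t : ℕ)
    (pts-unique : ∀ {e} → e ∈ edges → Unique (pts e))
    (length-pts : ∀ {e} → e ∈ edges → length (pts e) ≡ suc t)
    where

    open Update _≟_

    Independent : (V → Bool) → Set
    Independent D = ∀ {e} → e ∈ edges → ¬ All (T ∘ D) (pts e)

    count : (V → Bool) → ℕ
    count D = length (filter (λ v → T? (D v)) vertices)

    edge-nonempty : ∀ {e} → e ∈ edges → ∃ λ y → y ∈ pts e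
    edge-nonempty {e} e∈edges with pts e | length-pts e∈edges
    ... | y ∷ _ | _ = y , here refl

    -- A colouring ρ describes a random set: v is kept if ρ v = just true, dropped if
    -- ρ v = just false, and kept with probability a/b if ρ v = nothing.  Scaled by b and
    -- b^(t+1), mass and edgeMass are the expected numbers of kept vertices and of edges
    -- inside the set, and Good ρ says that their difference is at least its value for the
    -- fully random set.
    module _ {a b : ℕ} (0<a : 0 < a) (a≤b : a ≤ b) where

      open Convexity {a} {b} {b ∸ a} (m+[n∸m]≡n a≤b)

      weight : Maybe Bool → ℕ
      weight nothing      = a
      weight (just true)  = b
      weight (just false) = 0

      mass : (V → Maybe Bool) → ℕ
      mass ρ = sum (map (weight ∘ ρ) vertices)

      edgeWeight : (V → Maybe Bool) → E → ℕ
      edgeWeight ρ e = product (map (weight ∘ ρ) (pts e))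

      edgeMass : (V → Maybe Bool) → ℕ
      edgeMass ρ = sum (map (edgeWeight ρ) edges)

      undecided : V → Maybe Bool
      undecided = const nothing

      Good : (V → Maybe Bool) → Set
      Good ρ = b ^ t * mass undecided + edgeMass ρ ≤ b ^ t * mass ρ + edgeMass undecided

      Good-cong : ∀ {ρ ρ′} → ρ ≗ ρ′ → Good ρ → Good ρ′
      Good-cong {ρ} {ρ′} ρ≗ρ′ = subst₂ (λ M W → b ^ t * mass undecided + W ≤ b ^ t * M + edgeMass undecided)
        (cong sum (map-cong (cong weight ∘ ρ≗ρ′) vertices))
        (cong sum (map-cong (λ e → cong product (map-cong (cong weight ∘ ρ≗ρ′) (pts e))) edges))

      weight-convex : ∀ ρ y v →
        Convex (weight ((ρ [ y ≔ nothing ]) v)) (weight ((ρ [ y ≔ just true ]) v)) (weight ((ρ [ y ≔ just false ]) v))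
      weight-convex ρ y v with v ≟ y
      ... | yes _ = convex-extreme
      ... | no _  = convex-refl (weight (ρ v))

      product-convex : ∀ ρ y {xs} → Unique xs →
        Convex (product (map (weight ∘ ρ [ y ≔ nothing ]) xs)) (product (map (weight ∘ ρ [ y ≔ just true ]) xs))
               (product (map (weight ∘ ρ [ y ≔ just false ]) xs))
      product-convex ρ y {[]}     []                     = convex-refl 1
      product-convex ρ y {x ∷ xs} (x∉xs ∷ xs-unique) with x ≟ y
      ... | no _     = convex-*ˡ (weight (ρ x)) (product-convex ρ y xs-unique)
      ... | yes refl = subst₂ (λ P Q → Convex (a * P) (b * Q) 0) (sym (rest nothing)) (sym (rest (just true)))
        (convex-*ʳ (product (map (weight ∘ ρ) xs)) convex-extreme)
        where
        rest : ∀ c → product (map (weight ∘ ρ [ x ≔ c ]) xs) ≡ product (map (weight ∘ ρ) xs)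
        rest c = cong product (map-[≔]-∉ weight ρ c x∉xs)

      good-convex : ∀ ρ y → Good (ρ [ y ≔ nothing ]) → Good (ρ [ y ≔ just true ]) ⊎ Good (ρ [ y ≔ just false ])
      good-convex ρ y = convex-≤ 0<a
        (convex-+ (convex-refl _) (sum-convex edges (λ e∈edges → product-convex ρ y (pts-unique e∈edges))))
        (convex-+ (convex-*ˡ (b ^ t) (sum-convex vertices (λ {v} _ → weight-convex ρ y v))) (convex-refl _))

      fix-vertex : ∀ ρ y → Good ρ → ∃ λ c → Good (ρ [ y ≔ just c ])
      fix-vertex ρ y good with ρ y in ρy≡
      ... | just c  = c , Good-cong (sym ∘ [≔]-id ρ ρy≡) good
      ... | nothing with good-convex ρ y (Good-cong (sym ∘ [≔]-id ρ ρy≡) good)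
      ...   | inj₁ good-true  = true , good-true
      ...   | inj₂ good-false = false , good-false

      decide-all : ∀ vs ρ → (∀ v → ρ v ≡ nothing → v ∈ vs) → Good ρ → ∃ λ D → Good (just ∘ D)
      decide-all [] ρ undecided⊆[] good = fromMaybe false ∘ ρ , Good-cong decided good
        where
        decided : ρ ≗ just ∘ fromMaybe false ∘ ρ
        decided v with ρ v in ρv≡
        ... | just _  = refl
        ... | nothing with () ← undecided⊆[] v ρv≡
      decide-all (y ∷ vs) ρ undecided⊆y∷vs good with fix-vertex ρ y good
      ... | c , good′ = decide-all vs (ρ [ y ≔ just c ]) undecided⊆vs good′
        where
        undecided⊆vs : ∀ v → (ρ [ y ≔ just c ]) v ≡ nothing → v ∈ vs
        undecided⊆vs v ρ′v≡nothing with v ≟ y | undecided⊆y∷vs v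
        ... | no v≢y | v∈y∷vs with v∈y∷vs ρ′v≡nothing
        ...   | here v≡y   = ⊥-elim (v≢y v≡y)
        ...   | there v∈vs = v∈vs

      mass-decided : ∀ (D : V → Bool) vs → sum (map (weight ∘ just ∘ D) vs) ≡ b * length (filter (λ v → T? (D v)) vs)
      mass-decided D []       = sym (*-zeroʳ b)
      mass-decided D (v ∷ vs) with D v
      ... | true  = trans (cong (b +_) (mass-decided D vs)) (sym (*-suc b (length (filter (λ v → T? (D v)) vs))))
      ... | false = mass-decided D vs

      remove-vertex : ∀ D {e y} → e ∈ edges → All (T ∘ D) (pts e) → y ∈ pts e → Good (just ∘ D) →
        Good (just ∘ D [ y ≔ false ]) × mass (just ∘ D [ y ≔ false ]) < mass (just ∘ D)
      remove-vertex D {e} {y} e∈edges full y∈e good = good′ , mass-drop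
        where
        D′ = D [ y ≔ false ]
        Dy≡true : D y ≡ true
        Dy≡true = Equivalence.to T-≡ (All.lookup full y∈e)
        weight-≤ : ∀ v → weight (just (D′ v)) ≤ weight (just (D v))
        weight-≤ v with v ≟ y
        ... | yes _ = z≤n
        ... | no _  = ≤-refl
        mass-step : mass (just ∘ D′) + b ≡ mass (just ∘ D)
        mass-step = begin
          mass (just ∘ D′) + b
            ≡⟨ cong₂ _+_ (cong sum (map-cong weight′ vertices)) (cong (weight ∘ just) (sym Dy≡true)) ⟩
          sum (map ((weight ∘ just ∘ D) [ y ≔ 0 ]) vertices) + weight (just (D y))
            ≡⟨ sum-[≔] (weight ∘ just ∘ D) 0 vertices-unique (∈-vertices y) ⟩
          mass (just ∘ D) + 0
            ≡⟨ +-identityʳ _ ⟩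
          mass (just ∘ D)
            ∎
          where
          open ≡-Reasoning
          weight′ : weight ∘ just ∘ D′ ≗ (weight ∘ just ∘ D) [ y ≔ 0 ]
          weight′ v = trans (cong weight (∘-[≔] just D y false v)) (∘-[≔] weight (just ∘ D) y (just false) v)
        full-weight : edgeWeight (just ∘ D) e ≡ b ^ suc t
        full-weight = begin
          product (map (weight ∘ just ∘ D) (pts e))
            ≡⟨ cong product (map-cong-local (All.map (cong (weight ∘ just) ∘ Equivalence.to T-≡) full)) ⟩
          product (map (const b) (pts e))  ≡⟨ product-const (pts e) b ⟩
          b ^ length (pts e)               ≡⟨ cong (b ^_) (length-pts e∈edges) ⟩
          b ^ suc t                        ∎
          where open ≡-Reasoning
        edgeMass-drop : edgeMass (just ∘ D′) + b ^ suc t ≤ edgeMass (just ∘ D)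
        edgeMass-drop = sum-mono-with-gap (b ^ suc t) e∈edges (λ e′ → product-mono (pts e′) weight-≤)
          (≤-reflexive (cong₂ _+_ (product-zero (weight ∘ just ∘ D′) y∈e (cong (weight ∘ just) ([≔]-same D y false)))
                                  (sym full-weight)))
        good′ : Good (just ∘ D′)
        good′ = +-cancelʳ-≤ (b ^ suc t) _ _ (begin
          b ^ t * mass undecided + edgeMass (just ∘ D′) + b ^ suc t
            ≡⟨ +-assoc (b ^ t * mass undecided) _ _ ⟩
          b ^ t * mass undecided + (edgeMass (just ∘ D′) + b ^ suc t)
            ≤⟨ +-monoʳ-≤ (b ^ t * mass undecided) edgeMass-drop ⟩
          b ^ t * mass undecided + edgeMass (just ∘ D)
            ≤⟨ good ⟩
          b ^ t * mass (just ∘ D) + edgeMass undecided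
            ≡⟨ cong (λ m → b ^ t * m + edgeMass undecided) mass-step ⟨
          b ^ t * (mass (just ∘ D′) + b) + edgeMass undecided
            ≡⟨ regroup (b ^ t) b (mass (just ∘ D′)) (edgeMass undecided) ⟩
          b ^ t * mass (just ∘ D′) + edgeMass undecided + b ^ suc t
            ∎)
          where
          open ≤-Reasoning
          regroup : ∀ B b S K → B * (S + b) + K ≡ B * S + K + b * B
          regroup = solve-∀
        mass-drop : mass (just ∘ D′) < mass (just ∘ D)
        mass-drop = subst (mass (just ∘ D′) <_) mass-step (m<m+n _ (≤-trans 0<a a≤b))

      prune : ∀ D → Acc _<_ (mass (just ∘ D)) → Good (just ∘ D) → ∃ λ D′ → Independent D′ × Good (just ∘ D′)
      prune D (acc smaller) good with any? (λ e → All.all? (λ v → T? (D v)) (pts e)) edges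
      ... | no no-full = D , (λ e∈edges full → no-full (lose e∈edges full)) , good
      ... | yes some-full with find some-full
      ...   | e , e∈edges , full with edge-nonempty e∈edges
      ...     | y , y∈e with remove-vertex D e∈edges full y∈e good
      ...       | good′ , mass-drop = prune (D [ y ≔ false ]) (smaller mass-drop) good′

      mass-undecided : mass undecided ≡ length vertices * a
      mass-undecided = sum-const vertices a

      edgeMass-undecided : edgeMass undecided ≡ length edges * a ^ suc t
      edgeMass-undecided = trans
        (cong sum (map-cong-local (All.tabulate λ {e} e∈edges →
          trans (product-const (pts e) a) (cong (a ^_) (length-pts e∈edges)))))
        (sum-const edges (a ^ suc t))

      independent-set : ∃ λ D → Independent D × a * b ^ t * length vertices ≤ b ^ suc t * count D + a ^ suc t * length edges
      independent-set with decide-all vertices undecided (λ v _ → ∈-vertices v) ≤-refl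
      ... | D₀ , good₀ with prune D₀ (<-wellFounded _) good₀
      ... | D , independent , good = D , independent , (begin
        a * b ^ t * length vertices
          ≡⟨ trans (cong (b ^ t *_) mass-undecided) (reorder₁ a (b ^ t) (length vertices)) ⟨
        b ^ t * mass undecided
          ≤⟨ m≤m+n _ _ ⟩
        b ^ t * mass undecided + edgeMass (just ∘ D)
          ≤⟨ good ⟩
        b ^ t * mass (just ∘ D) + edgeMass undecided
          ≡⟨ cong₂ (λ m M → b ^ t * m + M) (mass-decided D vertices) edgeMass-undecided ⟩
        b ^ t * (b * count D) + length edges * a ^ suc t
          ≡⟨ reorder₂ (b ^ t) b (count D) (length edges) (a ^ suc t) ⟩
        b ^ suc t * count D + a ^ suc t * length edges
          ∎)
        where
        open ≤-Reasoning
        reorder₁ : ∀ a B V → B * (V * a) ≡ a * B * V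
        reorder₁ = solve-∀
        reorder₂ : ∀ B b C E A → B * (b * C) + E * A ≡ b * B * C + A * E
        reorder₂ = solve-∀

module HammingCube where

  open import Defs using (Cube; hamming)
  open import Data.Bool using (Bool; true; false; _xor_)
  open import Data.Bool.Properties using (xor-assoc; xor-same; xor-identityʳ; ⇔→≡)
  open import Data.Fin using (Fin; zero; suc)
  open import Data.Fin.Properties using (any?) renaming (_≟_ to _≟ᶠ_)
  open import Data.Fin.Subset using (Subset; ⊥; ⁅_⁆; _∈_; _∉_; _⊆_; _⊂_; _∩_; _∪_; _-_; ∣_∣; Nonempty)
  open import Data.Fin.Subset.Induction using (⊂-wellFounded)
  open import Data.Fin.Subset.Properties
  open import Data.Nat using (ℕ; suc; _+_; _*_; _≤_)
  open import Data.Nat.Properties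
  open import Data.Nat.Tactic.RingSolver using (solve-∀)
  open import Data.Product using (∃; _×_; _,_)
  open import Data.Sum using (_⊎_; inj₁; inj₂)
  open import Data.Vec using ([]; _∷_; zipWith; lookup)
  open import Data.Vec.Properties using ([]=⇒lookup; lookup⇒[]=)
  open import Function.Bundles using (mk⇔)
  open import Induction.WellFounded using (Acc; acc)
  open import Relation.Binary.PropositionalEquality
  open import Relation.Nullary using (¬_; yes; no; contradiction)

  infixl 6 _⊕_
  _⊕_ : ∀ {n} → Subset n → Subset n → Subset n
  _⊕_ = zipWith _xor_

  hamming≡∣⊕∣ : ∀ {n} (x y : Cube n) → hamming x y ≡ ∣ x ⊕ y ∣
  hamming≡∣⊕∣ []          []          = refl
  hamming≡∣⊕∣ (true ∷ x)  (true ∷ y)  = hamming≡∣⊕∣ x y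
  hamming≡∣⊕∣ (true ∷ x)  (false ∷ y) = cong suc (hamming≡∣⊕∣ x y)
  hamming≡∣⊕∣ (false ∷ x) (true ∷ y)  = cong suc (hamming≡∣⊕∣ x y)
  hamming≡∣⊕∣ (false ∷ x) (false ∷ y) = hamming≡∣⊕∣ x y

  p⊕⊥≡p : ∀ {n} (p : Subset n) → p ⊕ ⊥ ≡ p
  p⊕⊥≡p []      = refl
  p⊕⊥≡p (x ∷ p) = cong₂ _∷_ (xor-identityʳ x) (p⊕⊥≡p p)

  p⊕p≡⊥ : ∀ {n} (p : Subset n) → p ⊕ p ≡ ⊥
  p⊕p≡⊥ []      = refl
  p⊕p≡⊥ (x ∷ p) = cong₂ _∷_ (xor-same x) (p⊕p≡⊥ p)

  [p⊕q]⊕q≡p : ∀ {n} (p q : Subset n) → p ⊕ q ⊕ q ≡ p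
  [p⊕q]⊕q≡p []      []      = refl
  [p⊕q]⊕q≡p (x ∷ p) (y ∷ q) = cong₂ _∷_ x⊕y⊕y≡x ([p⊕q]⊕q≡p p q)
    where
    x⊕y⊕y≡x : (x xor y) xor y ≡ x
    x⊕y⊕y≡x = trans (xor-assoc x y y) (trans (cong (x xor_) (xor-same y)) (xor-identityʳ x))

  [p⊕r]⊕[q⊕r]≡p⊕q : ∀ {n} (p q r : Subset n) → (p ⊕ r) ⊕ (q ⊕ r) ≡ p ⊕ q
  [p⊕r]⊕[q⊕r]≡p⊕q []      []      []          = refl
  [p⊕r]⊕[q⊕r]≡p⊕q (x ∷ p) (y ∷ q) (false ∷ r) =
    cong₂ _∷_ (cong₂ _xor_ (xor-identityʳ x) (xor-identityʳ y)) ([p⊕r]⊕[q⊕r]≡p⊕q p q r)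
  [p⊕r]⊕[q⊕r]≡p⊕q (x ∷ p) (y ∷ q) (true ∷ r)  = cong₂ _∷_ (xor-not x y) ([p⊕r]⊕[q⊕r]≡p⊕q p q r)
    where
    xor-not : ∀ x y → (x xor true) xor (y xor true) ≡ x xor y
    xor-not false false = refl
    xor-not false true  = refl
    xor-not true  false = refl
    xor-not true  true  = refl

  ∣p⊕q∣+2∣p∩q∣≡∣p∣+∣q∣ : ∀ {n} (p q : Subset n) → ∣ p ⊕ q ∣ + 2 * ∣ p ∩ q ∣ ≡ ∣ p ∣ + ∣ q ∣
  ∣p⊕q∣+2∣p∩q∣≡∣p∣+∣q∣ []          []          = refl
  ∣p⊕q∣+2∣p∩q∣≡∣p∣+∣q∣ (true ∷ p)  (true ∷ q)  = begin
    ∣ p ⊕ q ∣ + 2 * suc ∣ p ∩ q ∣     ≡⟨ shift ∣ p ⊕ q ∣ ∣ p ∩ q ∣ ⟩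
    suc (suc (∣ p ⊕ q ∣ + 2 * ∣ p ∩ q ∣)) ≡⟨ cong (2 +_) (∣p⊕q∣+2∣p∩q∣≡∣p∣+∣q∣ p q) ⟩
    suc (suc (∣ p ∣ + ∣ q ∣))        ≡⟨ cong suc (+-suc ∣ p ∣ ∣ q ∣) ⟨
    suc ∣ p ∣ + suc ∣ q ∣            ∎
    where
    open ≡-Reasoning
    shift : ∀ X Y → X + 2 * suc Y ≡ suc (suc (X + 2 * Y))
    shift = solve-∀
  ∣p⊕q∣+2∣p∩q∣≡∣p∣+∣q∣ (true ∷ p)  (false ∷ q) = cong suc (∣p⊕q∣+2∣p∩q∣≡∣p∣+∣q∣ p q)
  ∣p⊕q∣+2∣p∩q∣≡∣p∣+∣q∣ (false ∷ p) (true ∷ q)  =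
    trans (cong suc (∣p⊕q∣+2∣p∩q∣≡∣p∣+∣q∣ p q)) (sym (+-suc ∣ p ∣ ∣ q ∣))
  ∣p⊕q∣+2∣p∩q∣≡∣p∣+∣q∣ (false ∷ p) (false ∷ q) = ∣p⊕q∣+2∣p∩q∣≡∣p∣+∣q∣ p q

  ∣p∪q∣+∣p∩q∣≡∣p∣+∣q∣ : ∀ {n} (p q : Subset n) → ∣ p ∪ q ∣ + ∣ p ∩ q ∣ ≡ ∣ p ∣ + ∣ q ∣
  ∣p∪q∣+∣p∩q∣≡∣p∣+∣q∣ []          []          = refl
  ∣p∪q∣+∣p∩q∣≡∣p∣+∣q∣ (true ∷ p)  (true ∷ q)  = cong suc (begin
    ∣ p ∪ q ∣ + suc ∣ p ∩ q ∣  ≡⟨ +-suc ∣ p ∪ q ∣ ∣ p ∩ q ∣ ⟩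
    suc (∣ p ∪ q ∣ + ∣ p ∩ q ∣) ≡⟨ cong suc (∣p∪q∣+∣p∩q∣≡∣p∣+∣q∣ p q) ⟩
    suc (∣ p ∣ + ∣ q ∣)        ≡⟨ +-suc ∣ p ∣ ∣ q ∣ ⟨
    ∣ p ∣ + suc ∣ q ∣          ∎)
    where open ≡-Reasoning
  ∣p∪q∣+∣p∩q∣≡∣p∣+∣q∣ (true ∷ p)  (false ∷ q) = cong suc (∣p∪q∣+∣p∩q∣≡∣p∣+∣q∣ p q)
  ∣p∪q∣+∣p∩q∣≡∣p∣+∣q∣ (false ∷ p) (true ∷ q)  =
    trans (cong suc (∣p∪q∣+∣p∩q∣≡∣p∣+∣q∣ p q)) (sym (+-suc ∣ p ∣ ∣ q ∣))
  ∣p∪q∣+∣p∩q∣≡∣p∣+∣q∣ (false ∷ p) (false ∷ q) = ∣p∪q∣+∣p∩q∣≡∣p∣+∣q∣ p q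

  p⊆q⇒∣q∣≤∣p∣⇒p≡q : ∀ {n} {p q : Subset n} → p ⊆ q → ∣ q ∣ ≤ ∣ p ∣ → p ≡ q
  p⊆q⇒∣q∣≤∣p∣⇒p≡q {p = p} p⊆q ∣q∣≤∣p∣ = ⊆-antisym p⊆q q⊆p
    where
    q⊆p : _ ⊆ p
    q⊆p {x} x∈q with x ∈? p
    ... | yes x∈p = x∈p
    ... | no  x∉p = contradiction (p⊂q⇒∣p∣<∣q∣ (p⊆q , x , x∈q , x∉p)) (≤⇒≯ ∣q∣≤∣p∣)

  x∈p⇒⁅x⁆⊆p : ∀ {n} {p : Subset n} {x} → x ∈ p → ⁅ x ⁆ ⊆ p
  x∈p⇒⁅x⁆⊆p {p = p} {x} x∈p y∈⁅x⁆ = subst (_∈ p) (sym (x∈⁅y⁆⇒x≡y x y∈⁅x⁆)) x∈p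

  x∈p⇒1≤∣p∣ : ∀ {n} {p : Subset n} {x} → x ∈ p → 1 ≤ ∣ p ∣
  x∈p⇒1≤∣p∣ {x = x} x∈p = subst (_≤ _) (∣⁅x⁆∣≡1 x) (p⊆q⇒∣p∣≤∣q∣ (x∈p⇒⁅x⁆⊆p x∈p))

  ∪-lub : ∀ {n} {p q r : Subset n} → p ⊆ r → q ⊆ r → p ∪ q ⊆ r
  ∪-lub {p = p} {q} p⊆r q⊆r x∈p∪q with x∈p∪q⁻ p q x∈p∪q
  ... | inj₁ x∈p = p⊆r x∈p
  ... | inj₂ x∈q = q⊆r x∈q

  [p-x]∪⁅x⁆≡p : ∀ {n} {p : Subset n} {x} → x ∈ p → (p - x) ∪ ⁅ x ⁆ ≡ p
  [p-x]∪⁅x⁆≡p {p = p} {x} x∈p = ⊆-antisym (∪-lub (p─q⊆p p ⁅ x ⁆) ⁅x⁆⊆p) p⊆[p-x]∪⁅x⁆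
    where
    ⁅x⁆⊆p = x∈p⇒⁅x⁆⊆p x∈p
    p⊆[p-x]∪⁅x⁆ : p ⊆ (p - x) ∪ ⁅ x ⁆
    p⊆[p-x]∪⁅x⁆ {y} y∈p with y ≟ᶠ x
    ... | yes refl = x∈p∪q⁺ (inj₂ (x∈⁅x⁆ x))
    ... | no  y≢x  = x∈p∪q⁺ (inj₁ (x∈p∧x≢y⇒x∈p-y y∈p y≢x))

  select : ∀ {k} → Subset k → Fin (suc k) → Bool
  select x zero    = false
  select x (suc i) = lookup x i

  module ScaledEmbedding {n k : ℕ} (g : Subset k → Subset n) (R : ℕ)
    (g-scaled : ∀ x y → ∣ g x ⊕ g y ∣ ≡ R * ∣ x ⊕ y ∣) (g⊥≡⊥ : g ⊥ ≡ ⊥) where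

    ∣gx∣≡R∣x∣ : ∀ x → ∣ g x ∣ ≡ R * ∣ x ∣
    ∣gx∣≡R∣x∣ x = begin
      ∣ g x ∣         ≡⟨ cong ∣_∣ (p⊕⊥≡p (g x)) ⟨
      ∣ g x ⊕ ⊥ ∣     ≡⟨ cong (λ z → ∣ g x ⊕ z ∣) g⊥≡⊥ ⟨
      ∣ g x ⊕ g ⊥ ∣   ≡⟨ g-scaled x ⊥ ⟩
      R * ∣ x ⊕ ⊥ ∣   ≡⟨ cong (λ z → R * ∣ z ∣) (p⊕⊥≡p x) ⟩
      R * ∣ x ∣       ∎
      where open ≡-Reasoning

    ∣gx∩gy∣≡R∣x∩y∣ : ∀ x y → ∣ g x ∩ g y ∣ ≡ R * ∣ x ∩ y ∣
    ∣gx∩gy∣≡R∣x∩y∣ x y = *-cancelˡ-≡ _ _ 2 (+-cancelˡ-≡ ∣ g x ⊕ g y ∣ _ _ (begin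
      ∣ g x ⊕ g y ∣ + 2 * ∣ g x ∩ g y ∣     ≡⟨ ∣p⊕q∣+2∣p∩q∣≡∣p∣+∣q∣ (g x) (g y) ⟩
      ∣ g x ∣ + ∣ g y ∣                     ≡⟨ cong₂ _+_ (∣gx∣≡R∣x∣ x) (∣gx∣≡R∣x∣ y) ⟩
      R * ∣ x ∣ + R * ∣ y ∣                 ≡⟨ *-distribˡ-+ R ∣ x ∣ ∣ y ∣ ⟨
      R * (∣ x ∣ + ∣ y ∣)                   ≡⟨ cong (R *_) (∣p⊕q∣+2∣p∩q∣≡∣p∣+∣q∣ x y) ⟨
      R * (∣ x ⊕ y ∣ + 2 * ∣ x ∩ y ∣)       ≡⟨ regroup R ∣ x ⊕ y ∣ ∣ x ∩ y ∣ ⟩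
      R * ∣ x ⊕ y ∣ + 2 * (R * ∣ x ∩ y ∣)   ≡⟨ cong (_+ _) (g-scaled x y) ⟨
      ∣ g x ⊕ g y ∣ + 2 * (R * ∣ x ∩ y ∣)   ∎))
      where
      open ≡-Reasoning
      regroup : ∀ R X Y → R * (X + 2 * Y) ≡ R * X + 2 * (R * Y)
      regroup = solve-∀

    g-mono : ∀ {x y} → y ⊆ x → g y ⊆ g x
    g-mono {x} {y} y⊆x = subst (_⊆ g x) gx∩gy≡gy (p∩q⊆p (g x) (g y))
      where
      open ≤-Reasoning
      gx∩gy≡gy : g x ∩ g y ≡ g y
      gx∩gy≡gy = p⊆q⇒∣q∣≤∣p∣⇒p≡q (p∩q⊆q (g x) (g y)) (begin
        ∣ g y ∣           ≡⟨ ∣gx∣≡R∣x∣ y ⟩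
        R * ∣ y ∣         ≤⟨ *-monoʳ-≤ R (p⊆q⇒∣p∣≤∣q∣ (λ j∈y → x∈p∩q⁺ (y⊆x j∈y , j∈y))) ⟩
        R * ∣ x ∩ y ∣     ≡⟨ ∣gx∩gy∣≡R∣x∩y∣ x y ⟨
        ∣ g x ∩ g y ∣     ∎)

    g-∪ : ∀ x y → g (x ∪ y) ≡ g x ∪ g y
    g-∪ x y = sym (p⊆q⇒∣q∣≤∣p∣⇒p≡q (∪-lub (g-mono (p⊆p∪q y)) (g-mono (q⊆p∪q x y)))
      (≤-reflexive (+-cancelʳ-≡ ∣ g x ∩ g y ∣ _ _ (begin
        ∣ g (x ∪ y) ∣ + ∣ g x ∩ g y ∣       ≡⟨ cong₂ _+_ (∣gx∣≡R∣x∣ (x ∪ y)) (∣gx∩gy∣≡R∣x∩y∣ x y) ⟩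
        R * ∣ x ∪ y ∣ + R * ∣ x ∩ y ∣       ≡⟨ *-distribˡ-+ R _ _ ⟨
        R * (∣ x ∪ y ∣ + ∣ x ∩ y ∣)         ≡⟨ cong (R *_) (∣p∪q∣+∣p∩q∣≡∣p∣+∣q∣ x y) ⟩
        R * (∣ x ∣ + ∣ y ∣)                 ≡⟨ *-distribˡ-+ R _ _ ⟩
        R * ∣ x ∣ + R * ∣ y ∣               ≡⟨ cong₂ _+_ (∣gx∣≡R∣x∣ x) (∣gx∣≡R∣x∣ y) ⟨
        ∣ g x ∣ + ∣ g y ∣                   ≡⟨ ∣p∪q∣+∣p∩q∣≡∣p∣+∣q∣ (g x) (g y) ⟨
        ∣ g x ∪ g y ∣ + ∣ g x ∩ g y ∣       ∎))))
      where open ≡-Reasoning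

    g-disjoint : ∀ {i i′ j} → i ≢ i′ → j ∈ g ⁅ i ⁆ → j ∉ g ⁅ i′ ⁆
    g-disjoint {i} {i′} i≢i′ j∈gi j∈gi′ = contradiction (begin
      1                               ≤⟨ x∈p⇒1≤∣p∣ (x∈p∩q⁺ (j∈gi , j∈gi′)) ⟩
      ∣ g ⁅ i ⁆ ∩ g ⁅ i′ ⁆ ∣          ≡⟨ ∣gx∩gy∣≡R∣x∩y∣ ⁅ i ⁆ ⁅ i′ ⁆ ⟩
      R * ∣ ⁅ i ⁆ ∩ ⁅ i′ ⁆ ∣          ≡⟨ cong (λ z → R * ∣ z ∣) (Empty-unique disjoint) ⟩
      R * ∣ ⊥ {n = k} ∣               ≡⟨ cong (R *_) (∣⊥∣≡0 k) ⟩
      R * 0                           ≡⟨ *-zeroʳ R ⟩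
      0                               ∎) λ ()
      where
      open ≤-Reasoning
      disjoint : ¬ Nonempty (⁅ i ⁆ ∩ ⁅ i′ ⁆)
      disjoint (l , l∈∩) with x∈p∩q⁻ ⁅ i ⁆ ⁅ i′ ⁆ l∈∩
      ... | l∈i , l∈i′ = i≢i′ (trans (sym (x∈⁅y⁆⇒x≡y i l∈i)) (x∈⁅y⁆⇒x≡y i′ l∈i′))

    g-split : ∀ {i j x} → i ∈ x → j ∈ g x → j ∈ g (x - i) ⊎ j ∈ g ⁅ i ⁆
    g-split {i} {j} {x} i∈x j∈gx = x∈p∪q⁻ (g (x - i)) (g ⁅ i ⁆)
      (subst (j ∈_) (trans (cong g (sym ([p-x]∪⁅x⁆≡p i∈x))) (g-∪ (x - i) ⁅ i ⁆)) j∈gx)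

    g-cover : ∀ {j} x → j ∈ g x → ∃ λ i → i ∈ x × j ∈ g ⁅ i ⁆
    g-cover x = cover x (⊂-wellFounded x)
      where
      cover : ∀ {j} x → Acc _⊂_ x → j ∈ g x → ∃ λ i → i ∈ x × j ∈ g ⁅ i ⁆
      cover x (acc smaller) j∈gx with nonempty? x
      ... | no  x-empty = contradiction (subst (_ ∈_) (trans (cong g (Empty-unique x-empty)) g⊥≡⊥) j∈gx) ∉⊥
      ... | yes (i , i∈x) with g-split i∈x j∈gx
      ...   | inj₂ j∈gi     = i , i∈x , j∈gi
      ...   | inj₁ j∈g[x-i] with cover (x - i) (smaller (x∈p⇒p-x⊂p i∈x)) j∈g[x-i]
      ...     | i′ , i′∈x-i , j∈gi′ = i′ , p─q⊆p x ⁅ i ⁆ i′∈x-i , j∈gi′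

    source : Fin n → Fin (suc k)
    source j with any? (λ i → j ∈? g ⁅ i ⁆)
    ... | yes (i , _) = suc i
    ... | no _        = zero

    source-sound : ∀ {i j} → source j ≡ suc i → j ∈ g ⁅ i ⁆
    source-sound {j = j} with any? (λ i → j ∈? g ⁅ i ⁆)
    ... | yes (i , j∈gi) = λ { refl → j∈gi }

    source-complete : ∀ {i j} → j ∈ g ⁅ i ⁆ → source j ≡ suc i
    source-complete {i} {j} j∈gi with any? (λ i → j ∈? g ⁅ i ⁆)
    ... | no none = contradiction (i , j∈gi) none
    ... | yes (i′ , j∈gi′) with i′ ≟ᶠ i
    ...   | yes refl = refl
    ...   | no i′≢i  = contradiction j∈gi (g-disjoint i′≢i j∈gi′)

    g≡select∘source : ∀ x j → lookup (g x) j ≡ select x (source j)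
    g≡select∘source x j = ⇔→≡ (mk⇔ to from)
      where
      to : lookup (g x) j ≡ true → select x (source j) ≡ true
      to gxj with g-cover x (lookup⇒[]= j (g x) gxj)
      ... | i , i∈x , j∈gi rewrite source-complete j∈gi = []=⇒lookup i∈x
      from : select x (source j) ≡ true → lookup (g x) j ≡ true
      from xsj with source j in eq
      ... | suc i = []=⇒lookup (g-mono (x∈p⇒⁅x⁆⊆p (lookup⇒[]= i x xsj)) (source-sound eq))

    source-onto : 1 ≤ R → ∀ i → ∃ λ j → source j ≡ suc i
    source-onto 1≤R i with nonempty? (g ⁅ i ⁆)
    ... | yes (j , j∈gi) = j , source-complete j∈gi
    ... | no  gi-empty   = contradiction (begin
      1               ≤⟨ 1≤R ⟩
      R               ≡⟨ *-identityʳ R ⟨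
      R * 1           ≡⟨ cong (R *_) (∣⁅x⁆∣≡1 i) ⟨
      R * ∣ ⁅ i ⁆ ∣   ≡⟨ ∣gx∣≡R∣x∣ ⁅ i ⁆ ⟨
      ∣ g ⁅ i ⁆ ∣     ≡⟨ cong ∣_∣ (Empty-unique gi-empty) ⟩
      ∣ ⊥ {n = n} ∣   ≡⟨ ∣⊥∣≡0 n ⟩
      0               ∎) λ ()
      where open ≤-Reasoning

module Fractions where

  open import Defs using (ℕtoℚ; _^ℚ_)
  open import Data.Integer as ℤ using (+_; -[1+_])
  import Data.Integer.Properties as ℤ
  open import Data.Nat using (zero; suc; _+_; _*_; _^_; _≤_; _<_; NonZero)
  open import Data.Nat.Properties using (m*n≢0; m^n≢0; *-comm; *-identityˡ; *-identityʳ; +-identityʳ)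
  open import Data.Product using (∃₂; _,_)
  open import Data.Rational as ℚ using (ℚ; mkℚ; 0ℚ; 1ℚ; ½; toℚᵘ)
  open import Data.Rational.Properties using (toℚᵘ-homo-*; toℚᵘ-fromℚᵘ; toℚᵘ-cancel-≤; toℚᵘ-mono-<)
  open import Data.Rational.Unnormalised as ℚᵘ using (_≃_; _/_; *≡*; *≤*; *<*)
  open import Data.Rational.Unnormalised.Properties using (≃-refl; ≃-sym; ≃-trans; *-cong; ≤-respˡ-≃; ≤-respʳ-≃; <-respˡ-≃; <-respʳ-≃)
  open import Relation.Binary.PropositionalEquality

  /-homo-* : ∀ {m n d e} .{{_ : NonZero d}} .{{_ : NonZero e}} →
    (+ m / d) ℚᵘ.* (+ n / e) ≃ (+ (m * n) / (d * e)) {{m*n≢0 d e}}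
  /-homo-* {m} {n} {suc d} {suc e} = *≡* (cong (ℤ._* + suc (e + d * suc e)) (sym (ℤ.pos-* m n)))

  /-mono-≤ : ∀ {m n d e} .{{_ : NonZero d}} .{{_ : NonZero e}} → m * e ≤ n * d → + m / d ℚᵘ.≤ + n / e
  /-mono-≤ {m} {n} {suc _} {suc _} me≤nd = *≤* (subst₂ ℤ._≤_ (ℤ.pos-* m _) (ℤ.pos-* n _) (ℤ.+≤+ me≤nd))

  /-cancel-< : ∀ {m n d e} .{{_ : NonZero d}} .{{_ : NonZero e}} → + m / d ℚᵘ.< + n / e → m * e < n * d
  /-cancel-< {m} {n} {suc _} {suc _} (*<* me<nd) = ℤ.drop‿+<+ (subst₂ ℤ._<_ (sym (ℤ.pos-* m _)) (sym (ℤ.pos-* n _)) me<nd)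

  /-injective : ∀ {m n d e} .{{_ : NonZero d}} .{{_ : NonZero e}} → + m / d ≃ + n / e → m * e ≡ n * d
  /-injective {m} {n} {suc _} {suc _} (*≡* me≡nd) = ℤ.+-injective (trans (ℤ.pos-* m _) (trans me≡nd (sym (ℤ.pos-* n _))))

  toℚᵘ-ℕtoℚ : ∀ n → toℚᵘ (ℕtoℚ n) ≃ + n / 1
  toℚᵘ-ℕtoℚ n = toℚᵘ-fromℚᵘ (+ n / 1)

  toℚᵘ-* : ∀ {p q m n d e} .{{_ : NonZero d}} .{{_ : NonZero e}} → toℚᵘ p ≃ + m / d → toℚᵘ q ≃ + n / e →
    toℚᵘ (p ℚ.* q) ≃ (+ (m * n) / (d * e)) {{m*n≢0 d e}}
  toℚᵘ-* {p} {q} p≃ q≃ = ≃-trans (toℚᵘ-homo-* p q) (≃-trans (*-cong p≃ q≃) /-homo-*)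

  toℚᵘ-^ : ∀ {p m d} .{{_ : NonZero d}} → toℚᵘ p ≃ + m / d →
    ∀ k → toℚᵘ (p ^ℚ k) ≃ (+ (m ^ k) / (d ^ k)) {{m^n≢0 d k}}
  toℚᵘ-^ p≃ zero    = ≃-refl
  toℚᵘ-^ {d = d} p≃ (suc k) = toℚᵘ-* {{_}} {{m^n≢0 d k}} p≃ (toℚᵘ-^ p≃ k)

  fraction-≤ : ∀ {p q m n d e} .{{_ : NonZero d}} .{{_ : NonZero e}} → toℚᵘ p ≃ + m / d → toℚᵘ q ≃ + n / e →
    m * e ≤ n * d → p ℚ.≤ q
  fraction-≤ p≃ q≃ me≤nd = toℚᵘ-cancel-≤ (≤-respˡ-≃ (≃-sym p≃) (≤-respʳ-≃ (≃-sym q≃) (/-mono-≤ me≤nd)))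

  fraction-< : ∀ {p q m n d e} .{{_ : NonZero d}} .{{_ : NonZero e}} → toℚᵘ p ≃ + m / d → toℚᵘ q ≃ + n / e →
    p ℚ.< q → m * e < n * d
  fraction-< p≃ q≃ p<q = /-cancel-< (<-respˡ-≃ p≃ (<-respʳ-≃ q≃ (toℚᵘ-mono-< p<q)))

  fraction-≡ : ∀ {p q m n d e} .{{_ : NonZero d}} .{{_ : NonZero e}} → toℚᵘ p ≃ + m / d → toℚᵘ q ≃ + n / e →
    p ≡ q → m * e ≡ n * d
  fraction-≡ p≃ q≃ refl = /-injective (≃-trans (≃-sym p≃) q≃)

  positive-fraction : ∀ δ → 0ℚ ℚ.< δ → ∃₂ λ u w → toℚᵘ δ ≃ + u / suc w
  positive-fraction (mkℚ (+ u)    w _) _         = u , w , ≃-refl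
  positive-fraction (mkℚ -[1+ _ ] _ _) (ℚ.*<* ())

  fraction-pos : ∀ {p m d} .{{_ : NonZero d}} → toℚᵘ p ≃ + m / d → 0ℚ ℚ.< p → 0 < m
  fraction-pos {m = m} p≃ 0<p = subst (0 <_) (*-identityʳ m) (fraction-< ≃-refl p≃ 0<p)

  fraction<½ : ∀ {p m d} .{{_ : NonZero d}} → toℚᵘ p ≃ + m / d → p ℚ.< ½ → 2 * m < d
  fraction<½ {m = m} {d} p≃ p<½ = subst₂ _<_ (*-comm m 2) (+-identityʳ d) (fraction-< p≃ ≃-refl p<½)

  fraction*ℕ≤ℕ : ∀ {p m d M C} .{{_ : NonZero d}} → toℚᵘ p ≃ + m / d →
    m * M ≤ d * C → p ℚ.* ℕtoℚ M ℚ.≤ ℕtoℚ C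
  fraction*ℕ≤ℕ {m = m} {d} {M} {C} p≃ mM≤dC =
    fraction-≤ {{m*n≢0 d 1}} (toℚᵘ-* p≃ (toℚᵘ-ℕtoℚ M)) (toℚᵘ-ℕtoℚ C)
    (subst₂ _≤_ (sym (*-identityʳ (m * M))) (trans (*-comm d C) (cong (C *_) (sym (*-identityʳ d)))) mM≤dC)

  1≤fraction*ℕ : ∀ {p m d K} .{{_ : NonZero d}} → toℚᵘ p ≃ + m / d → d ≤ m * K → 1ℚ ℚ.≤ p ℚ.* ℕtoℚ K
  1≤fraction*ℕ {m = m} {d} {K} p≃ d≤mK = fraction-≤ {{_}} {{m*n≢0 d 1}} ≃-refl (toℚᵘ-* p≃ (toℚᵘ-ℕtoℚ K))
    (subst₂ _≤_ (sym (trans (*-identityˡ (d * 1)) (*-identityʳ d))) (sym (*-identityʳ (m * K))) d≤mK)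

module Powers where

  open import Data.Nat using (ℕ; zero; suc; >-nonZero; _+_; _*_; _∸_; _^_; _≤_; _<_; _≤?_; s≤s; z≤n)
  open import Data.Nat.Properties
  open import Data.Nat.Tactic.RingSolver using (solve-∀)
  open import Data.Product using (∃₂; _×_; _,_)
  open import Relation.Binary.PropositionalEquality
  open import Relation.Nullary using (yes; no; contradiction)

  ^-distribʳ-* : ∀ m n k → (m * n) ^ k ≡ m ^ k * n ^ k
  ^-distribʳ-* m n zero    = refl
  ^-distribʳ-* m n (suc k) = trans (cong (m * n *_) (^-distribʳ-* m n k)) (regroup m n (m ^ k) (n ^ k))
    where
    regroup : ∀ m n M N → m * n * (M * N) ≡ m * M * (n * N)
    regroup = solve-∀

  ^-cancelˡ-≤ : ∀ k {m n} → m ^ suc k ≤ n ^ suc k → m ≤ n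
  ^-cancelˡ-≤ k {m} {n} mᵏ≤nᵏ with m ≤? n
  ... | yes m≤n = m≤n
  ... | no  m≰n = contradiction mᵏ≤nᵏ (<⇒≱ (^-monoˡ-< (suc k) (≰⇒> m≰n)))

  ^-comm : ∀ m i j → (m ^ i) ^ j ≡ (m ^ j) ^ i
  ^-comm m i j = trans (^-*-assoc m i j) (trans (cong (m ^_) (*-comm i j)) (sym (^-*-assoc m j i)))

  [1+k]⁴≤k⁵ : ∀ {k} → 4 ≤ k → suc k ^ 4 ≤ k ^ 5
  [1+k]⁴≤k⁵ {k} 4≤k = *-cancelˡ-≤ (4 ^ 4) (begin
    4 ^ 4 * suc k ^ 4   ≡⟨ ^-distribʳ-* 4 (suc k) 4 ⟨
    (4 * suc k) ^ 4     ≤⟨ ^-monoˡ-≤ 4 (4[1+k]≤5k) ⟩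
    (5 * k) ^ 4         ≡⟨ ^-distribʳ-* 5 k 4 ⟩
    5 ^ 4 * k ^ 4       ≤⟨ *-monoˡ-≤ (k ^ 4) (≤-trans (≤ᵇ⇒≤ (5 ^ 4) (4 ^ 4 * 4) _) (*-monoʳ-≤ (4 ^ 4) 4≤k)) ⟩
    4 ^ 4 * k * k ^ 4   ≡⟨ *-assoc (4 ^ 4) k (k ^ 4) ⟩
    4 ^ 4 * k ^ 5       ∎)
    where
    open ≤-Reasoning
    4[1+k]≤5k : 4 * suc k ≤ 5 * k
    4[1+k]≤5k = subst (_≤ 5 * k) (sym (*-suc 4 k)) (+-monoˡ-≤ (4 * k) 4≤k)

  [1+k]ᴺ⁴≤k⁵ᴺ : ∀ {k} N → 4 ≤ k → (suc k ^ N) ^ 4 ≤ k ^ (5 * N)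
  [1+k]ᴺ⁴≤k⁵ᴺ {k} N 4≤k = begin
    (suc k ^ N) ^ 4   ≡⟨ ^-comm (suc k) N 4 ⟩
    (suc k ^ 4) ^ N   ≤⟨ ^-monoˡ-≤ N ([1+k]⁴≤k⁵ 4≤k) ⟩
    (k ^ 5) ^ N       ≡⟨ ^-*-assoc k 5 N ⟩
    k ^ (5 * N)       ∎
    where open ≤-Reasoning

  small-δ-bound : ∀ r {E u v} → 4 * u ≤ v → E ^ 4 * u ^ (4 + r) ≤ v ^ (4 + r) →
    E * 2 ^ (4 + r) * u ^ (3 + r) ≤ v ^ (3 + r)
  small-δ-bound r {E} {u} {v} 4u≤v E⁴uˢ≤vˢ = ^-cancelˡ-≤ 3 (begin
    (E * 2 ^ s * u ^ t) ^ 4                ≡⟨ ^-distribʳ-* (E * 2 ^ s) (u ^ t) 4 ⟩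
    (E * 2 ^ s) ^ 4 * (u ^ t) ^ 4          ≡⟨ cong₂ _*_ (^-distribʳ-* E (2 ^ s) 4) (^-*-assoc u t 4) ⟩
    E ^ 4 * (2 ^ s) ^ 4 * u ^ (t * 4)      ≡⟨ cong (λ i → E ^ 4 * (2 ^ s) ^ 4 * u ^ i) t*4≡s+m ⟩
    E ^ 4 * (2 ^ s) ^ 4 * u ^ (s + m)      ≡⟨ cong (E ^ 4 * (2 ^ s) ^ 4 *_) (^-distribˡ-+-* u s m) ⟩
    E ^ 4 * (2 ^ s) ^ 4 * (u ^ s * u ^ m)  ≡⟨ regroup (E ^ 4) ((2 ^ s) ^ 4) (u ^ s) (u ^ m) ⟩
    E ^ 4 * u ^ s * ((2 ^ s) ^ 4 * u ^ m)  ≤⟨ *-mono-≤ E⁴uˢ≤vˢ (*-monoˡ-≤ (u ^ m) 2⁴ˢ≤4ᵐ) ⟩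
    v ^ s * (4 ^ m * u ^ m)                ≡⟨ cong (v ^ s *_) (^-distribʳ-* 4 u m) ⟨
    v ^ s * (4 * u) ^ m                    ≤⟨ *-monoʳ-≤ (v ^ s) (^-monoˡ-≤ m 4u≤v) ⟩
    v ^ s * v ^ m                          ≡⟨ ^-distribˡ-+-* v s m ⟨
    v ^ (s + m)                            ≡⟨ cong (v ^_) t*4≡s+m ⟨
    v ^ (t * 4)                            ≡⟨ ^-*-assoc v t 4 ⟨
    (v ^ t) ^ 4                            ∎)
    where
    open ≤-Reasoning
    s t m : ℕ
    s = 4 + r
    t = 3 + r
    m = 8 + 3 * r
    t*4≡s+m : t * 4 ≡ s + m
    t*4≡s+m = solve-∀′ r
      where
      solve-∀′ : ∀ r → (3 + r) * 4 ≡ 4 + r + (8 + 3 * r)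
      solve-∀′ = solve-∀
    regroup : ∀ A B C D → A * B * (C * D) ≡ A * C * (B * D)
    regroup = solve-∀
    2⁴ˢ≤4ᵐ : (2 ^ s) ^ 4 ≤ 4 ^ m
    2⁴ˢ≤4ᵐ = begin
      (2 ^ s) ^ 4    ≡⟨ ^-*-assoc 2 s 4 ⟩
      2 ^ (s * 4)    ≤⟨ ^-monoʳ-≤ 2 (s*4≤2*m r) ⟩
      2 ^ (2 * m)    ≡⟨ ^-*-assoc 2 2 m ⟨
      4 ^ m          ∎
      where
      s*4≤2*m : ∀ r → (4 + r) * 4 ≤ 2 * (8 + 3 * r)
      s*4≤2*m r = subst₂ _≤_ (lhs r) (rhs r) (+-monoʳ-≤ (16 + 4 * r) (z≤n {2 * r}))
        where
        lhs : ∀ r → 16 + 4 * r + 0 ≡ (4 + r) * 4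
        lhs = solve-∀
        rhs : ∀ r → 16 + 4 * r + 2 * r ≡ 2 * (8 + 3 * r)
        rhs = solve-∀

  power-gap : ∀ {c a b} n r → c * a ^ n ≤ b ^ n → a ≤ b → c * a ^ (n + r) ≤ b ^ (n + r)
  power-gap {c} {a} {b} n r caⁿ≤bⁿ a≤b = begin
    c * a ^ (n + r)       ≡⟨ cong (c *_) (^-distribˡ-+-* a n r) ⟩
    c * (a ^ n * a ^ r)   ≡⟨ *-assoc c (a ^ n) (a ^ r) ⟨
    c * a ^ n * a ^ r     ≤⟨ *-mono-≤ caⁿ≤bⁿ (^-monoˡ-≤ r a≤b) ⟩
    b ^ n * b ^ r         ≡⟨ ^-distribˡ-+-* b n r ⟨
    b ^ (n + r)           ∎
    where open ≤-Reasoning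

  large-δ-bound : ∀ {s E} → 10 ^ 4 * 324 ^ s ≤ 625 ^ s → E ^ 4 ≤ 4 ^ s → 10 * E * 3 ^ s ≤ 5 ^ s
  large-δ-bound {s} {E} 10⁴324ˢ≤625ˢ E⁴≤4ˢ = ^-cancelˡ-≤ 3 (begin
    (10 * E * 3 ^ s) ^ 4              ≡⟨ ^-distribʳ-* (10 * E) (3 ^ s) 4 ⟩
    (10 * E) ^ 4 * (3 ^ s) ^ 4        ≡⟨ cong₂ _*_ (^-distribʳ-* 10 E 4) (^-comm 3 s 4) ⟩
    10 ^ 4 * E ^ 4 * 81 ^ s           ≤⟨ *-monoˡ-≤ (81 ^ s) (*-monoʳ-≤ (10 ^ 4) E⁴≤4ˢ) ⟩
    10 ^ 4 * 4 ^ s * 81 ^ s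
      ≡⟨ trans (cong (10 ^ 4 *_) (^-distribʳ-* 4 81 s)) (sym (*-assoc (10 ^ 4) (4 ^ s) (81 ^ s))) ⟨
    10 ^ 4 * 324 ^ s                  ≤⟨ 10⁴324ˢ≤625ˢ ⟩
    625 ^ s                           ≡⟨ ^-comm 5 4 s ⟩
    (5 ^ s) ^ 4                       ∎)
    where open ≤-Reasoning

  -- The constants of power-gap are given explicitly: inferring them makes Agda unfold
  -- 10 ^ 4 * 324 ^ (16 + r) by unary recursion.
  10⁴324ˢ≤625ˢ : ∀ {s} → 16 ≤ s → 10 ^ 4 * 324 ^ s ≤ 625 ^ s
  10⁴324ˢ≤625ˢ {s} 16≤s = subst (λ s → 10 ^ 4 * 324 ^ s ≤ 625 ^ s) (m+[n∸m]≡n 16≤s)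
    (power-gap {10 ^ 4} {324} {625} 16 (s ∸ 16) (≤ᵇ⇒≤ (10 ^ 4 * 324 ^ 16) (625 ^ 16) _) (≤ᵇ⇒≤ 324 625 _))

  -- a/b is the density of the random set: 2δ if δ ≤ 1/4, and 3/5 otherwise.
  choose-density : ∀ {t E K u v} → 15 ≤ t → E ^ 4 ≤ K → 0 < u → 2 * u < v → u ^ suc t * K < v ^ suc t →
    ∃₂ λ a b → 0 < a × a ≤ b × u * b ^ suc t + v * E * a ^ suc t ≤ v * a * b ^ t
  choose-density {t} {E} {K} {u} {v} 15≤t E⁴≤K 0<u 2u<v uˢK<vˢ with 4 * u ≤? v
  ... | yes 4u≤v = 2 * u , v , ≤-trans 0<u (m≤m+n u (u + 0)) , <⇒≤ 2u<v , (begin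
    u * v ^ suc t + v * E * (2 * u) ^ suc t
      ≡⟨ cong (λ z → u * v ^ suc t + v * E * z) (^-distribʳ-* 2 u (suc t)) ⟩
    u * (v * v ^ t) + v * E * (2 ^ suc t * (u * u ^ t))
      ≡⟨ regroup u v (v ^ t) E (2 ^ suc t) (u ^ t) ⟩
    u * v * v ^ t + u * v * (E * 2 ^ suc t * u ^ t)
      ≤⟨ +-monoʳ-≤ (u * v * v ^ t) (*-monoʳ-≤ (u * v) sparse-bound) ⟩
    u * v * v ^ t + u * v * v ^ t
      ≡⟨ double u v (v ^ t) ⟩
    v * (2 * u) * v ^ t
      ∎)
    where
    open ≤-Reasoning
    E⁴uˢ≤vˢ : E ^ 4 * u ^ suc t ≤ v ^ suc t
    E⁴uˢ≤vˢ = ≤-trans (*-monoˡ-≤ (u ^ suc t) E⁴≤K) (≤-trans (≤-reflexive (*-comm K (u ^ suc t))) (<⇒≤ uˢK<vˢ))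
    sparse-bound : E * 2 ^ suc t * u ^ t ≤ v ^ t
    sparse-bound = subst (λ t → E ^ 4 * u ^ suc t ≤ v ^ suc t → E * 2 ^ suc t * u ^ t ≤ v ^ t)
      (m+[n∸m]≡n (≤-trans (≤ᵇ⇒≤ 3 15 _) 15≤t)) (small-δ-bound (t ∸ 3) {E} {u} {v} 4u≤v) E⁴uˢ≤vˢ
    regroup : ∀ u v V E P U → u * (v * V) + v * E * (P * (u * U)) ≡ u * v * V + u * v * (E * P * U)
    regroup = solve-∀
    double : ∀ u v V → u * v * V + u * v * V ≡ v * (2 * u) * V
    double = solve-∀
  ... | no 4u≰v = 3 , 5 , s≤s z≤n , ≤ᵇ⇒≤ 3 5 _ , *-cancelˡ-≤ 10 (begin
    10 * (u * 5 ^ suc t + v * E * 3 ^ suc t)          ≡⟨ regroup u v E (5 ^ t) (3 ^ suc t) ⟩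
    25 * (2 * u) * 5 ^ t + v * (10 * E * 3 ^ suc t)
      ≤⟨ +-mono-≤ (*-monoˡ-≤ (5 ^ t) (*-monoʳ-≤ 25 (<⇒≤ 2u<v))) (*-monoʳ-≤ v 10E3ˢ≤5ˢ) ⟩
    25 * v * 5 ^ t + v * 5 ^ suc t                    ≡⟨ collect v (5 ^ t) ⟩
    10 * (v * 3 * 5 ^ t)                              ∎)
    where
    open ≤-Reasoning
    K<4ˢ : K < 4 ^ suc t
    K<4ˢ = *-cancelˡ-< (u ^ suc t) K (4 ^ suc t) (begin-strict
      u ^ suc t * K           <⟨ uˢK<vˢ ⟩
      v ^ suc t               ≤⟨ ^-monoˡ-≤ (suc t) (<⇒≤ (≰⇒> 4u≰v)) ⟩
      (4 * u) ^ suc t         ≡⟨ ^-distribʳ-* 4 u (suc t) ⟩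
      4 ^ suc t * u ^ suc t   ≡⟨ *-comm (4 ^ suc t) (u ^ suc t) ⟩
      u ^ suc t * 4 ^ suc t   ∎)
    10E3ˢ≤5ˢ : 10 * E * 3 ^ suc t ≤ 5 ^ suc t
    10E3ˢ≤5ˢ = large-δ-bound {suc t} {E} (10⁴324ˢ≤625ˢ (s≤s 15≤t)) (≤-trans E⁴≤K (<⇒≤ K<4ˢ))
    regroup : ∀ u v E F T → 10 * (u * (5 * F) + v * E * T) ≡ 25 * (2 * u) * F + v * (10 * E * T)
    regroup = solve-∀
    collect : ∀ v F → 25 * v * F + v * (5 * F) ≡ 10 * (v * 3 * F)
    collect = solve-∀

  deletion-bound⇒density : ∀ {a b t M C E D u v} → 0 < b →
    a * b ^ t * M ≤ b ^ suc t * D + a ^ suc t * C → C ≤ M * E →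
    u * b ^ suc t + v * E * a ^ suc t ≤ v * a * b ^ t → u * M ≤ v * D
  deletion-bound⇒density {a} {b} {t} {M} {C} {E} {D} {u} {v} 0<b deletion C≤ME balance =
    *-cancelˡ-≤ (b ^ suc t) {{m^n≢0 b (suc t) {{>-nonZero 0<b}}}} (+-cancelʳ-≤ (v * a ^ suc t * C) _ _ (begin
      b ^ suc t * (u * M) + v * a ^ suc t * C
        ≤⟨ +-monoʳ-≤ (b ^ suc t * (u * M)) (*-monoʳ-≤ (v * a ^ suc t) C≤ME) ⟩
      b ^ suc t * (u * M) + v * a ^ suc t * (M * E)      ≡⟨ factor-M (b ^ suc t) u M v (a ^ suc t) E ⟩
      M * (u * b ^ suc t + v * E * a ^ suc t)            ≤⟨ *-monoʳ-≤ M balance ⟩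
      M * (v * a * b ^ t)                                ≡⟨ factor-v M v a (b ^ t) ⟩
      v * (a * b ^ t * M)                                ≤⟨ *-monoʳ-≤ v deletion ⟩
      v * (b ^ suc t * D + a ^ suc t * C)                ≡⟨ expand v (b ^ suc t) D (a ^ suc t) C ⟩
      b ^ suc t * (v * D) + v * a ^ suc t * C            ∎))
    where
    open ≤-Reasoning
    factor-M : ∀ B u M v A E → B * (u * M) + v * A * (M * E) ≡ M * (u * B + v * E * A)
    factor-M = solve-∀
    factor-v : ∀ M v a T → M * (v * a * T) ≡ v * (a * T * M)
    factor-v = solve-∀
    expand : ∀ v B D A C → v * (B * D + A * C) ≡ B * (v * D) + v * A * C
    expand = solve-∀

module CubeCopies where

  open import Defs
  open import Data.Bool using (true; false; T)
  open import Data.Bool.Properties using () renaming (_≟_ to _≟ᵇ_)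
  open import Data.Empty using (⊥-elim)
  open import Data.Fin using (Fin; zero; suc; fromℕ<) renaming (_≟_ to _≟ᶠ_)
  open import Data.Fin.Properties using (all?; any?)
  open import Data.Fin.Subset using (⊥; ⁅_⁆; ∣_∣)
  open import Data.Fin.Subset.Properties using (∣⁅x⁆∣≡1)
  open import Data.List using (List; []; _∷_; _++_; length; filter; cartesianProduct; cartesianProductWith; allFin)
  import Data.List as List
  open import Data.List.Membership.Propositional using (_∈_)
  open import Data.List.Membership.Propositional.Properties using (∈-map⁺; ∈-map⁻; ∈-++⁺ˡ; ∈-++⁺ʳ; ∈-filter⁺; ∈-filter⁻; ∈-cartesianProductWith⁺; ∈-cartesianProduct⁺; ∈-allFin)
  open import Data.List.Properties using (length-++; length-map; length-filter; length-tabulate)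
  open import Data.List.Relation.Unary.All as All using (All; [])
  import Data.List.Relation.Unary.All.Properties as All
  open import Data.List.Relation.Unary.Any using (here)
  open import Data.List.Relation.Unary.AllPairs using ([]; _∷_)
  open import Data.List.Relation.Unary.Unique.Propositional using (Unique)
  import Data.List.Relation.Unary.Unique.Propositional.Properties as Unique
  open import Data.Nat using (ℕ; zero; suc; pred; _+_; _*_; _^_; _≤_; _<_; _≤?_; s≤s; z≤n)
  open import Data.Nat.Properties
  open import Data.Product using (∃; _×_; _,_; proj₂)
  open import Data.Rational as ℚ using (0ℚ)
  import Data.Rational.Properties as ℚ
  open import Data.Rational.Unnormalised.Properties using (≃-refl)
  open import Data.Vec using (Vec; []; _∷_; map; lookup; tabulate)
  open import Data.Vec.Properties using (lookup-map; lookup∘tabulate; tabulate∘lookup; tabulate-cong; ≡-dec)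
  open import Function using (_∘_)
  open import Relation.Binary.PropositionalEquality
  open import Relation.Nullary using (¬_; Dec; yes; no)

  open Hypergraphs
  open HammingCube
  open Fractions
  open Powers

  length-allPoints : ∀ N → length (allPoints N) ≡ 2 ^ N
  length-allPoints zero    = refl
  length-allPoints (suc N) = begin
    length (List.map (false ∷_) (allPoints N) ++ List.map (true ∷_) (allPoints N))
      ≡⟨ length-++ (List.map (false ∷_) (allPoints N)) ⟩
    length (List.map (false ∷_) (allPoints N)) + length (List.map (true ∷_) (allPoints N))
      ≡⟨ cong₂ _+_ (length-map (false ∷_) (allPoints N)) (length-map (true ∷_) (allPoints N)) ⟩
    length (allPoints N) + length (allPoints N)
      ≡⟨ cong (λ n → n + n) (length-allPoints N) ⟩
    2 ^ N + 2 ^ N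
      ≡⟨ cong (2 ^ N +_) (+-identityʳ (2 ^ N)) ⟨
    2 ^ suc N ∎
    where open ≡-Reasoning

  ∈-allPoints : ∀ {N} (x : Cube N) → x ∈ allPoints N
  ∈-allPoints []          = here refl
  ∈-allPoints (false ∷ x) = ∈-++⁺ˡ (∈-map⁺ (false ∷_) (∈-allPoints x))
  ∈-allPoints (true ∷ x)  = ∈-++⁺ʳ _ (∈-map⁺ (true ∷_) (∈-allPoints x))

  allPoints-unique : ∀ N → Unique (allPoints N)
  allPoints-unique zero    = [] ∷ []
  allPoints-unique (suc N) =
    Unique.++⁺ (Unique.map⁺ ∷-injectiveʳ (allPoints-unique N)) (Unique.map⁺ ∷-injectiveʳ (allPoints-unique N)) disjoint
    where
    ∷-injectiveʳ : ∀ {b} {x y : Cube N} → b ∷ x ≡ b ∷ y → x ≡ y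
    ∷-injectiveʳ refl = refl
    disjoint : ∀ {x} → ¬ (x ∈ List.map (false ∷_) (allPoints N) × x ∈ List.map (true ∷_) (allPoints N))
    disjoint (x∈false , x∈true) with ∈-map⁻ (false ∷_) x∈false | ∈-map⁻ (true ∷_) x∈true
    ... | _ , _ , refl | _ , _ , ()

  length-cartesianProductWith : ∀ {A B C : Set} (f : A → B → C) xs ys →
    length (cartesianProductWith f xs ys) ≡ length xs * length ys
  length-cartesianProductWith f []       ys = refl
  length-cartesianProductWith f (x ∷ xs) ys = trans (length-++ (List.map (f x) ys))
    (cong₂ _+_ (length-map (f x) ys) (length-cartesianProductWith f xs ys))

  allVecs : ∀ {A : Set} → List A → ∀ n → List (Vec A n)
  allVecs xs zero    = [] ∷ []
  allVecs xs (suc n) = cartesianProductWith _∷_ xs (allVecs xs n)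

  length-allVecs : ∀ {A : Set} (xs : List A) n → length (allVecs xs n) ≡ length xs ^ n
  length-allVecs xs zero    = refl
  length-allVecs xs (suc n) =
    trans (length-cartesianProductWith _∷_ xs (allVecs xs n)) (cong (length xs *_) (length-allVecs xs n))

  ∈-allVecs : ∀ {A : Set} {xs : List A} → (∀ x → x ∈ xs) → ∀ {n} (v : Vec A n) → v ∈ allVecs xs n
  ∈-allVecs ∈xs []      = here refl
  ∈-allVecs ∈xs (x ∷ v) = ∈-cartesianProductWith⁺ _∷_ (∈xs x) (∈-allVecs ∈xs v)

  lookup-ext : ∀ {A : Set} {n} {u v : Vec A n} → (∀ j → lookup u j ≡ lookup v j) → u ≡ v
  lookup-ext {u = u} {v} u≗v = trans (sym (tabulate∘lookup u)) (trans (tabulate-cong u≗v) (tabulate∘lookup v))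

  -- A copy of {0,1}^k in {0,1}^N is given by a base point p and an assignment σ:
  -- coordinate j of the image of x is p_j flipped by x_i if σ j = suc i, and p_j if σ j = zero.
  Assignment : ℕ → ℕ → Set
  Assignment N k = Vec (Fin (suc k)) N

  copy : ∀ {N k} → Cube N → Assignment N k → Cube k → Cube N
  copy p σ x = map (select x) σ ⊕ p

  Valid : ∀ {N k} → Assignment N k → Set
  Valid σ = ∀ i → ∃ λ j → lookup σ j ≡ suc i

  valid? : ∀ {N k} (σ : Assignment N k) → Dec (Valid σ)
  valid? σ = all? λ i → any? λ j → lookup σ j ≟ᶠ suc i

  copy-injective : ∀ {N k} (p : Cube N) {σ : Assignment N k} → Valid σ → ∀ {x y} → copy p σ x ≡ copy p σ y → x ≡ y
  copy-injective p {σ} valid {x} {y} eq = lookup-ext λ i → let j , σj≡1+i = valid i in begin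
    select x (suc i)               ≡⟨ cong (select x) σj≡1+i ⟨
    select x (lookup σ j)          ≡⟨ lookup-map j (select x) σ ⟨
    lookup (map (select x) σ) j    ≡⟨ cong (λ z → lookup z j) selections ⟩
    lookup (map (select y) σ) j    ≡⟨ lookup-map j (select y) σ ⟩
    select y (lookup σ j)          ≡⟨ cong (select y) σj≡1+i ⟩
    select y (suc i)               ∎
    where
    open ≡-Reasoning
    selections : map (select x) σ ≡ map (select y) σ
    selections = trans (sym ([p⊕q]⊕q≡p _ p)) (trans (cong (_⊕ p) eq) ([p⊕q]⊕q≡p _ p))

  embedding-is-copy : ∀ {N k} (f : Cube k → Cube N) R → 1 ≤ R → (∀ x y → hamming (f x) (f y) ≡ R * hamming x y) →
    ∃ λ σ → Valid σ × ∀ x → f x ≡ copy (f ⊥) σ x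
  embedding-is-copy {N} {k} f R 1≤R scaled = tabulate source , valid , f≡copy
    where
    g : Cube k → Cube N
    g x = f x ⊕ f ⊥
    g-scaled : ∀ x y → ∣ g x ⊕ g y ∣ ≡ R * ∣ x ⊕ y ∣
    g-scaled x y = begin
      ∣ g x ⊕ g y ∣        ≡⟨ cong ∣_∣ ([p⊕r]⊕[q⊕r]≡p⊕q (f x) (f y) (f ⊥)) ⟩
      ∣ f x ⊕ f y ∣        ≡⟨ hamming≡∣⊕∣ (f x) (f y) ⟨
      hamming (f x) (f y)  ≡⟨ scaled x y ⟩
      R * hamming x y      ≡⟨ cong (R *_) (hamming≡∣⊕∣ x y) ⟩
      R * ∣ x ⊕ y ∣        ∎
      where open ≡-Reasoning
    open ScaledEmbedding g R g-scaled (p⊕p≡⊥ (f ⊥))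
    valid : Valid (tabulate source)
    valid i = let j , source-j≡1+i = source-onto 1≤R i in j , trans (lookup∘tabulate source j) source-j≡1+i
    f≡copy : ∀ x → f x ≡ copy (f ⊥) (tabulate source) x
    f≡copy x = trans (sym ([p⊕q]⊕q≡p (f x) (f ⊥))) (cong (_⊕ f ⊥) (lookup-ext λ j → begin
      lookup (g x) j                             ≡⟨ g≡select∘source x j ⟩
      select x (source j)                        ≡⟨ cong (select x) (lookup∘tabulate source j) ⟨
      select x (lookup (tabulate source) j)      ≡⟨ lookup-map j (select x) (tabulate source) ⟨
      lookup (map (select x) (tabulate source)) j ∎))
      where open ≡-Reasoning

  integral-scale : ∀ {N k r} (f : Cube k → Cube N) → 0 < k → 0ℚ ℚ.< r →
    (∀ x y → ℕtoℚ (hamming (f x) (f y)) ≡ r ℚ.* ℕtoℚ (hamming x y)) →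
    ∃ λ R → 1 ≤ R × ∀ x y → hamming (f x) (f y) ≡ R * hamming x y
  integral-scale {r = r} f 0<k 0<r scaled = R , 1≤R , scaledℕ
    where
    e : Cube _
    e = ⁅ fromℕ< 0<k ⁆
    R : ℕ
    R = hamming (f e) (f ⊥)
    r≡R : r ≡ ℕtoℚ R
    r≡R = sym (begin
      ℕtoℚ R                            ≡⟨ scaled e ⊥ ⟩
      r ℚ.* ℕtoℚ (hamming e ⊥)          ≡⟨ cong (λ n → r ℚ.* ℕtoℚ n) ∣e⊕⊥∣≡1 ⟩
      r ℚ.* ℕtoℚ 1                      ≡⟨ ℚ.*-identityʳ r ⟩
      r                                 ∎)
      where
      open ≡-Reasoning
      ∣e⊕⊥∣≡1 : hamming e ⊥ ≡ 1
      ∣e⊕⊥∣≡1 = trans (hamming≡∣⊕∣ e ⊥) (trans (cong ∣_∣ (p⊕⊥≡p e)) (∣⁅x⁆∣≡1 (fromℕ< 0<k)))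
    1≤R : 1 ≤ R
    1≤R = subst (0 <_) (*-identityʳ R) (fraction-< ≃-refl (toℚᵘ-ℕtoℚ R) (subst (0ℚ ℚ.<_) r≡R 0<r))
    scaledℕ : ∀ x y → hamming (f x) (f y) ≡ R * hamming x y
    scaledℕ x y = begin
      hamming (f x) (f y)              ≡⟨ *-identityʳ _ ⟨
      hamming (f x) (f y) * 1
        ≡⟨ fraction-≡ (toℚᵘ-ℕtoℚ (hamming (f x) (f y))) (toℚᵘ-* (toℚᵘ-ℕtoℚ R) (toℚᵘ-ℕtoℚ (hamming x y)))
                      (trans (scaled x y) (cong (ℚ._* ℕtoℚ (hamming x y)) r≡R)) ⟩
      R * hamming x y * 1              ≡⟨ *-identityʳ _ ⟩
      R * hamming x y                  ∎
      where open ≡-Reasoning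

  module CopyHypergraph (N k t : ℕ) (1+t≡2ᵏ : suc t ≡ 2 ^ k) where

    Copy : Set
    Copy = Cube N × Assignment N k

    candidates : List Copy
    candidates = cartesianProduct (allPoints N) (allVecs (allFin (suc k)) N)

    copies : List Copy
    copies = filter (λ c → valid? (proj₂ c)) candidates

    points : Copy → List (Cube N)
    points (p , σ) = List.map (copy p σ) (allPoints k)

    length-copies : length copies ≤ 2 ^ N * suc k ^ N
    length-copies = begin
      length copies                                      ≤⟨ length-filter (λ c → valid? (proj₂ c)) candidates ⟩
      length candidates                                  ≡⟨ length-cartesianProductWith _,_ (allPoints N) _ ⟩
      length (allPoints N) * length (allVecs (allFin (suc k)) N)
        ≡⟨ cong₂ _*_ (length-allPoints N) (trans (length-allVecs _ N) (cong (_^ N) (length-tabulate (λ i → i)))) ⟩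
      2 ^ N * suc k ^ N                                  ∎
      where open ≤-Reasoning

    points-unique : ∀ {c} → c ∈ copies → Unique (points c)
    points-unique {p , σ} c∈copies =
      Unique.map⁺ (copy-injective p (proj₂ (∈-filter⁻ (λ c → valid? (proj₂ c)) {xs = candidates} c∈copies)))
                  (allPoints-unique k)

    length-points : ∀ c → length (points c) ≡ suc t
    length-points (p , σ) = trans (length-map (copy p σ) (allPoints k)) (trans (length-allPoints k) (sym 1+t≡2ᵏ))

    open DeletionMethod (≡-dec _≟ᵇ_) (allPoints N) (allPoints-unique N) ∈-allPoints
                        copies points t points-unique (λ _ → length-points _)
      public using (Independent; independent-set)

    embedding⇒¬independent : ∀ {D} → 0 < k → ScaledEmbeddingInto k D → ¬ Independent D
    embedding⇒¬independent {D} 0<k (r , 0<r , f , f∈D , scaled) independent with integral-scale f 0<k 0<r scaled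
    ... | R , 1≤R , scaledℕ with embedding-is-copy f R 1≤R scaledℕ
    ... | σ , valid , f≡copy =
      independent copy∈copies (All.map⁺ (All.tabulate λ {x} _ → subst (T ∘ D) (f≡copy x) (f∈D x)))
      where
      copy∈copies : (f ⊥ , σ) ∈ copies
      copy∈copies =
        ∈-filter⁺ (λ c → valid? (proj₂ c)) (∈-cartesianProduct⁺ (∈-allPoints (f ⊥)) (∈-allVecs ∈-allFin σ)) valid

    large-independent-set : ∀ {a b u v} → 0 < a → a ≤ b → u * b ^ suc t + v * suc k ^ N * a ^ suc t ≤ v * a * b ^ t →
      ∃ λ D → Independent D × u * 2 ^ N ≤ v * card D
    large-independent-set {a} {b} {u} {v} 0<a a≤b balance =
      let D , independent , deletion = independent-set 0<a a≤b
      in D , independent ,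
         deletion-bound⇒density {a} {b} {t} {2 ^ N} {length copies} {suc k ^ N} {card D} {u} {v} (≤-trans 0<a a≤b)
           (subst (λ M → a * b ^ t * M ≤ b ^ suc t * card D + a ^ suc t * length copies) (length-allPoints N) deletion)
           length-copies balance

  embedding-property-bound : ∀ {k N u v} → 4 ≤ k → 0 < u → 2 * u < v →
    (∀ D → u * 2 ^ N ≤ v * card D → ScaledEmbeddingInto k D) →
    v ^ 2 ^ k ≤ u ^ 2 ^ k * k ^ (5 * N)
  embedding-property-bound {k} {N} {u} {v} 4≤k 0<u 2u<v emb with v ^ 2 ^ k ≤? u ^ 2 ^ k * k ^ (5 * N)
  ... | yes vˢ≤uˢK = vˢ≤uˢK
  ... | no  vˢ≰uˢK =
    let a , b , 0<a , a≤b , balance =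
          choose-density {t} {suc k ^ N} {k ^ (5 * N)} {u} {v} 15≤t ([1+k]ᴺ⁴≤k⁵ᴺ N 4≤k) 0<u 2u<v uᵗ⁺¹K<vᵗ⁺¹
        D , independent , uM≤vD = large-independent-set {a} {b} {u} {v} 0<a a≤b balance
    in ⊥-elim (embedding⇒¬independent (≤-trans (s≤s z≤n) 4≤k) (emb D uM≤vD) independent)
    where
    t : ℕ
    t = pred (2 ^ k)
    1+t≡2ᵏ : suc t ≡ 2 ^ k
    1+t≡2ᵏ = suc-pred (2 ^ k) {{m^n≢0 2 k}}
    15≤t : 15 ≤ t
    15≤t = pred-mono-≤ (^-monoʳ-≤ 2 4≤k)
    uᵗ⁺¹K<vᵗ⁺¹ : u ^ suc t * k ^ (5 * N) < v ^ suc t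
    uᵗ⁺¹K<vᵗ⁺¹ = subst (λ s → u ^ s * k ^ (5 * N) < v ^ s) (sym 1+t≡2ᵏ) (≰⇒> vˢ≰uˢK)
    open CopyHypergraph N k t 1+t≡2ᵏ

open import Defs
open import Data.Nat using (ℕ; _≥_; _*_)
open import Data.Rational using (ℚ; _<_; _≤_; 0ℚ; 1ℚ; ½)
import Data.Nat as ℕ
import Data.Nat.Properties as ℕ
open import Data.Product using (_,_)
open Fractions using (positive-fraction; fraction-pos; fraction<½; fraction*ℕ≤ℕ; 1≤fraction*ℕ; toℚᵘ-^)
open CubeCopies using (embedding-property-bound)

mainTheorem8 : (k : ℕ) → k ≥ 4 → (δ : ℚ) → 0ℚ < δ → δ < ½ →
    (N : ℕ) → EmbProperty δ k N →
    1ℚ ≤ (δ ^ℚ (2 Data.Nat.^ k)) Data.Rational.* ℕtoℚ (k Data.Nat.^ (5 * N))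
mainTheorem8 k k≥4 δ 0<δ δ<½ N emb with positive-fraction δ 0<δ
... | u , w , δ≃u/v = 1≤fraction*ℕ {{ℕ.m^n≢0 (ℕ.suc w) (2 ℕ.^ k)}} (toℚᵘ-^ δ≃u/v (2 ℕ.^ k))
  (embedding-property-bound k≥4 (fraction-pos δ≃u/v 0<δ) (fraction<½ δ≃u/v δ<½)
    λ D uM≤vD → emb D (fraction*ℕ≤ℕ δ≃u/v uM≤vD))
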